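{- For each tree $T$, $E_{pure}(T)\subseteq E_{pure}(T^2)$.
   Context: For a tree $T=(V,E)$, $E_{pure}(T)$ is the set of all $F\subseteq E$ with $2deg_F(u)<deg(u)$ for every $u\in V$, where $deg_F(u)$ is the number of edges of $F$ incident to $u$ and $deg(u)$ is the degree of $u$ in $T$. $T^2$ is the tree obtained from $T$ by repeatedly removing a node $w$ of degree $2$ and joining its two neighbors by a new edge, until no node of degree $2$ remains; it is uniquely defined, $deg_{T^2}(v)=deg_T(v)$ for each node $v$ of $T^2$, and every edge of $T$ with no end node of degree $2$ is also an edge of $T^2$ (this identification of edges is used in the inclusion). -}

module Defs where

open import Data.Nat using (ℕ; zero; suc; _+_; _*_; _≤_; _<_)
open import Data.Fin using (Fin; zero; suc; _≟_)
open import Data.Bool using (Bool; true; false; _∧_; _∨_; not; if_then_else_)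
open import Data.List using (List; []; _∷_; _++_; [_]; length)
open import Data.List.Relation.Unary.Linked using (Linked)
open import Data.List.Relation.Unary.Unique.Propositional using (Unique)
open import Data.Product using (Σ; _×_; ∃)
open import Relation.Nullary using (¬_)
open import Relation.Nullary.Decidable using (⌊_⌋)
open import Relation.Binary.PropositionalEquality using (_≡_; _≢_)
open import Relation.Binary.Construct.Closure.ReflexiveTransitive using (Star)

-- A (simple, undirected) graph on vertex set Fin n is given by a Bool-valued
-- adjacency relation; an edge set F ⊆ E is likewise a symmetric Bool relation.
Adj : ℕ → Set
Adj n = Fin n → Fin n → Bool

count : ∀ {n} → (Fin n → Bool) → ℕ
count {zero} p = 0
count {suc n} p = (if p zero then 1 else 0) + count (λ i → p (suc i))

SymmetricAdj : ∀ {n} → Adj n → Set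
SymmetricAdj A = ∀ u v → A u v ≡ A v u

IrreflexiveAdj : ∀ {n} → Adj n → Set
IrreflexiveAdj A = ∀ u → A u u ≡ false

data Walk {n} (A : Adj n) : Fin n → Fin n → Set where
  here : ∀ {u} → Walk A u u
  step : ∀ {u w v} → A u w ≡ true → Walk A w v → Walk A u v

Connected : ∀ {n} → Adj n → Set
Connected A = ∀ u v → Walk A u v

HasCycle : ∀ {n} → Adj n → Set
HasCycle {n} A = Σ (Fin n) λ u → Σ (List (Fin n)) λ ws →
  (2 ≤ length ws) × Unique (u ∷ ws) × Linked (λ x y → A x y ≡ true) (u ∷ ws ++ [ u ])

IsTree : ∀ {n} → Adj n → Set
IsTree A = SymmetricAdj A × IrreflexiveAdj A × Connected A × ¬ HasCycle A

-- Intermediate graphs of the suppression process: the remaining ("alive")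
-- vertices together with the adjacency among them.
record State (n : ℕ) : Set where
  constructor st
  field
    alive : Fin n → Bool
    adj   : Adj n
open State public

full : ∀ {n} → Adj n → State n
full A = st (λ _ → true) A

deg : ∀ {n} → State n → Fin n → ℕ
deg G u = count (λ v → alive G v ∧ adj G u v)

eqb : ∀ {n} → Fin n → Fin n → Bool
eqb x y = ⌊ x ≟ y ⌋

suppress : ∀ {n} → State n → Fin n → Fin n → Fin n → State n
suppress G w a b = st
  (λ v → alive G v ∧ not (eqb v w))
  (λ x y → if eqb x w ∨ eqb y w then false
           else if (eqb x a ∧ eqb y b) ∨ (eqb x b ∧ eqb y a) then true
           else adj G x y)

data Step {n} : State n → State n → Set where
  suppr : ∀ G w a b → alive G w ≡ true → deg G w ≡ 2 →
          alive G a ≡ true → adj G w a ≡ true →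
          alive G b ≡ true → adj G w b ≡ true → a ≢ b →
          Step G (suppress G w a b)

NoDeg2 : ∀ {n} → State n → Set
NoDeg2 G = ∀ v → alive G v ≡ true → ¬ (deg G v ≡ 2)

IsT² : ∀ {n} → Adj n → State n → Set
IsT² T G = Star Step (full T) G × NoDeg2 G

SubsetE : ∀ {n} → State n → Adj n → Set
SubsetE G F = ∀ u v → F u v ≡ true → alive G u ≡ true × alive G v ≡ true × adj G u v ≡ true

degF : ∀ {n} → Adj n → Fin n → ℕ
degF F u = count (F u)

Pure : ∀ {n} → State n → Adj n → Set
Pure G F = SubsetE G F × (∀ u → alive G u ≡ true → 2 * degF F u < deg G u)

-- Suppressing a node w of degree 2 with neighbours a and b can only break purity at w
-- itself or at a and b. At w, 2 deg_F(w) < 2 forces deg_F(w) = 0, so (F being symmetric)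
-- no edge of F touches w and F survives the suppression. The degrees of a and b do not
-- drop, because in an acyclic graph a and b were not adjacent: each loses w and gains the
-- other. Acyclicity, in the form "no edge xy has a detour from x to y", is preserved by a
-- suppression, so purity propagates along the whole suppression sequence.
module Submission where

open import Defs
open import Level using (0ℓ)
open import Function using (id; _∘_)
open import Data.Nat using (ℕ; zero; suc; _+_; _*_; _≤_; _<_; z≤n; s≤s)
open import Data.Nat.Properties using (+-suc; ≤-trans; m≤n+m; <-≤-trans; *-cancelˡ-<; n<1⇒n≡0)
open import Data.Fin using (Fin; zero; suc; _≟_)
open import Data.Bool using (Bool; true; false; _∧_; _∨_; not; if_then_else_)
open import Data.Bool.Properties using (∧-identityʳ; ∧-comm; ∨-comm)
open import Data.Product using (Σ; ∃; _×_; _,_; proj₁; proj₂)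
open import Data.Sum using (_⊎_; inj₁; inj₂)
open import Data.List using (List; []; _∷_; _++_; [_])
open import Data.List.Relation.Unary.Linked using (Linked; [-]; _∷_)
open import Data.List.Relation.Unary.Unique.Propositional using (Unique)
open import Data.List.Relation.Unary.AllPairs using ([]; _∷_)
open import Data.List.Relation.Unary.All using ([])
open import Data.List.Relation.Unary.All.Properties using (¬Any⇒All¬)
open import Data.List.Relation.Unary.Any using (here; there)
open import Data.List.Membership.Propositional using (_∈_)
import Data.List.Membership.DecPropositional as DecMembership
open import Relation.Binary using (Rel; _⇒_; DecidableEquality)
open import Relation.Binary.Construct.Closure.ReflexiveTransitive using (Star; ε; _◅_; _◅◅_; map; concat)
open import Relation.Nullary using (¬_; Dec; yes; no; does; proof; Reflects; ofʸ; ofⁿ; contradiction)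
open import Relation.Nullary.Decidable using (isYes≗does; ⌊⌋-map′; _×-dec_; _⊎-dec_)
open import Relation.Binary.PropositionalEquality
  using (_≡_; _≢_; refl; sym; trans; cong; cong₂; subst; ≢-sym; module ≡-Reasoning)

∧≡true⁻ : ∀ {x y} → x ∧ y ≡ true → x ≡ true × y ≡ true
∧≡true⁻ {true} y≡true = refl , y≡true

∧≡true⁺ : ∀ {x y} → x ≡ true → y ≡ true → x ∧ y ≡ true
∧≡true⁺ refl refl = refl

eqb-refl : ∀ {n} (x : Fin n) → eqb x x ≡ true
eqb-refl x with x ≟ x
... | yes _   = refl
... | no  x≢x = contradiction refl x≢x

eqb-≢ : ∀ {n} {x y : Fin n} → x ≢ y → eqb x y ≡ false
eqb-≢ {x = x} {y} x≢y with x ≟ y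
... | yes x≡y = contradiction x≡y x≢y
... | no _    = refl

eqb-suc : ∀ {n} (x y : Fin n) → eqb (suc x) (suc y) ≡ eqb x y
eqb-suc x y = ⌊⌋-map′ _ _ (x ≟ y)

_without_ : ∀ {n} → (Fin n → Bool) → Fin n → Fin n → Bool
(p without x) v = p v ∧ not (eqb v x)

without⁺ : ∀ {n} {p : Fin n → Bool} {x v} → p v ≡ true → v ≢ x → (p without x) v ≡ true
without⁺ pv v≢x = ∧≡true⁺ pv (cong not (eqb-≢ v≢x))

without⁻ : ∀ {n} {p : Fin n → Bool} {x v} → (p without x) v ≡ true → p v ≡ true × v ≢ x
without⁻ {v = v} h with ∧≡true⁻ h
... | pv , ¬v≟x = pv , λ { refl → contradiction (trans (sym (cong not (eqb-refl v))) ¬v≟x) λ () }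

count-cong : ∀ {n} {p q : Fin n → Bool} → (∀ v → p v ≡ q v) → count p ≡ count q
count-cong {zero}  _   = refl
count-cong {suc n} p≗q rewrite p≗q zero = cong (_ +_) (count-cong (p≗q ∘ suc))

count-mono : ∀ {n} {p q : Fin n → Bool} → (∀ v → p v ≡ true → q v ≡ true) → count p ≤ count q
count-mono {zero}  _ = z≤n
count-mono {suc n} {p} p⊆q with p zero in p0
... | true rewrite p⊆q zero p0 = s≤s (count-mono (p⊆q ∘ suc))
... | false = ≤-trans (count-mono (p⊆q ∘ suc)) (m≤n+m _ _)

count-without : ∀ {n} {p : Fin n → Bool} {x} → p x ≡ true → count p ≡ suc (count (p without x))
count-without {suc n} {p} {zero} px rewrite px =
  cong suc (count-cong λ i → sym (∧-identityʳ (p (suc i))))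
count-without {suc n} {p} {suc y} px rewrite ∧-identityʳ (p zero) = begin
  head + count (p ∘ suc)                     ≡⟨ cong (head +_) (count-without {p = p ∘ suc} px) ⟩
  head + suc (count ((p ∘ suc) without y))   ≡⟨ +-suc head _ ⟩
  suc (head + count ((p ∘ suc) without y))   ≡⟨ cong (λ c → suc (head + c)) (count-cong shift) ⟩
  suc (head + count (λ i → (p without suc y) (suc i))) ∎
  where
  open ≡-Reasoning
  head : ℕ
  head = if p zero then 1 else 0
  shift : ∀ i → ((p ∘ suc) without y) i ≡ (p without suc y) (suc i)
  shift i = cong (λ e → p (suc i) ∧ not e) (sym (eqb-suc i y))

count-exchange-≤ : ∀ {n} {p q : Fin n → Bool} {x y} → p x ≡ true → q y ≡ true →
                   (∀ v → (p without x) v ≡ true → (q without y) v ≡ true) → count p ≤ count q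
count-exchange-≤ {p = p} {q} px qy p⊆q
  rewrite count-without {p = p} px | count-without {p = q} qy = s≤s (count-mono p⊆q)

count≥3 : ∀ {n} {p : Fin n → Bool} {x y z} → p x ≡ true → p y ≡ true → p z ≡ true →
          x ≢ y → x ≢ z → y ≢ z → 3 ≤ count p
count≥3 {p = p} {x} {y} {z} px py pz x≢y x≢z y≢z
  rewrite count-without {p = p} px
        | count-without {p = p without x} {y} (without⁺ {p = p} py (≢-sym x≢y))
        | count-without {p = (p without x) without y} {z}
            (without⁺ {p = p without x} (without⁺ {p = p} pz (≢-sym x≢z)) (≢-sym y≢z))
  = s≤s (s≤s (s≤s z≤n))

count≡0⇒false : ∀ {n} {p : Fin n → Bool} x → count p ≡ 0 → p x ≡ false
count≡0⇒false {p = p} x count≡0 with p x in px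
... | false = refl
... | true  = contradiction (trans (sym (count-without {p = p} px)) count≡0) λ ()

module _ {A : Set} {R : Rel A 0ℓ} where

  visits : ∀ {u v} → Star R u v → List A
  visits ε                 = []
  visits (_◅_ {j = w} _ p) = w ∷ visits p

  linked : ∀ {S : Rel A 0ℓ} → R ⇒ S → ∀ {u v z} (p : Star R u v) → S v z →
           Linked S (u ∷ visits p ++ [ z ])
  linked f ε       s = s ∷ [-]
  linked f (r ◅ p) s = f r ∷ linked f p s

  module _ (_≟ᴬ_ : DecidableEquality A) where
    open DecMembership _≟ᴬ_ using (_∈?_)

    suffix-from : ∀ {u v z} (p : Star R u v) → z ∈ u ∷ visits p →
                  Σ (Star R z v) λ q → Unique (u ∷ visits p) → Unique (z ∷ visits q)
    suffix-from p       (here refl) = p , id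
    suffix-from (_ ◅ p) (there z∈)  with suffix-from p z∈
    ... | q , unique = q , λ { (_ ∷ u) → unique u }

    loop-erase : ∀ {u v} (p : Star R u v) → Σ (Star R u v) λ q → Unique (u ∷ visits q)
    loop-erase ε = ε , [] ∷ []
    loop-erase {u} (r ◅ p) with loop-erase p
    ... | q , unique with u ∈? _ ∷ visits q
    ...   | yes u∈ = let (q′ , unique′) = suffix-from q u∈ in q′ , unique′ unique
    ...   | no u∉  = r ◅ q , ¬Any⇒All¬ _ u∉ ∷ unique

SamePair : ∀ {n} → Fin n → Fin n → Fin n → Fin n → Set
SamePair x y u v = (u ≡ x × v ≡ y) ⊎ (u ≡ y × v ≡ x)

samePair-swap : ∀ {n} {x y u v : Fin n} → SamePair x y u v → SamePair x y v u
samePair-swap (inj₁ (u≡x , v≡y)) = inj₂ (v≡y , u≡x)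
samePair-swap (inj₂ (u≡y , v≡x)) = inj₁ (v≡x , u≡y)

samePair-euclidean : ∀ {n} {a b x y p q : Fin n} →
                     SamePair a b x y → SamePair a b p q → SamePair x y p q
samePair-euclidean (inj₁ (refl , refl)) (inj₁ (refl , refl)) = inj₁ (refl , refl)
samePair-euclidean (inj₁ (refl , refl)) (inj₂ (refl , refl)) = inj₂ (refl , refl)
samePair-euclidean (inj₂ (refl , refl)) (inj₁ (refl , refl)) = inj₂ (refl , refl)
samePair-euclidean (inj₂ (refl , refl)) (inj₂ (refl , refl)) = inj₁ (refl , refl)

samePair-reflects : ∀ {n} (a b p q : Fin n) →
                    Reflects (SamePair a b p q) ((eqb p a ∧ eqb q b) ∨ (eqb p b ∧ eqb q a))
samePair-reflects a b p q = subst (Reflects _) (sym tests≡) (proof samePair?)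
  where
  samePair? : Dec (SamePair a b p q)
  samePair? = (p ≟ a ×-dec q ≟ b) ⊎-dec (p ≟ b ×-dec q ≟ a)
  tests≡ : (eqb p a ∧ eqb q b) ∨ (eqb p b ∧ eqb q a) ≡ does samePair?
  tests≡ = cong₂ _∨_ (cong₂ _∧_ (isYes≗does (p ≟ a)) (isYes≗does (q ≟ b)))
                     (cong₂ _∧_ (isYes≗does (p ≟ b)) (isYes≗does (q ≟ a)))

adjacent⇒≢ : ∀ {n} {A : Adj n} → IrreflexiveAdj A → ∀ {x y} → A x y ≡ true → x ≢ y
adjacent⇒≢ irr {x} xy refl = contradiction (trans (sym xy) (irr x)) λ ()

EdgeAvoiding : ∀ {n} → Adj n → Fin n → Fin n → Rel (Fin n) 0ℓ
EdgeAvoiding A x y u v = A u v ≡ true × ¬ SamePair x y u v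

Acyclic : ∀ {n} → Adj n → Set
Acyclic A = ∀ {x y} → A x y ≡ true → ¬ Star (EdgeAvoiding A x y) x y

-- a loop-erased detour around the edge xy, followed by yx, is a cycle
tree⇒acyclic : ∀ {n} {T : Adj n} → IsTree T → Acyclic T
tree⇒acyclic {T = T} (T-sym , T-irr , _ , no-cycle) {x} {y} xy detour with loop-erase _≟_ detour
... | ε , _                     = adjacent⇒≢ {A = T} T-irr xy refl
... | (_ , avoids) ◅ ε , _      = avoids (inj₁ (refl , refl))
... | cycle@(_ ◅ _ ◅ _) , unique =
  no-cycle (x , visits cycle , s≤s (s≤s z≤n) , unique , linked proj₁ cycle (trans (T-sym y x) xy))

module Suppression {n} (G : State n) (w a b : Fin n) where

  N : State n
  N = suppress G w a b

  alive-suppress⁺ : ∀ {v} → alive G v ≡ true → v ≢ w → alive N v ≡ true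
  alive-suppress⁺ {v} alive-v v≢w = without⁺ {p = alive G} alive-v v≢w

  alive-suppress⁻ : ∀ {v} → alive N v ≡ true → alive G v ≡ true × v ≢ w
  alive-suppress⁻ = without⁻ {p = alive G}

  adj-suppress⁺ : ∀ {p q} → p ≢ w → q ≢ w → SamePair a b p q ⊎ adj G p q ≡ true →
                  adj N p q ≡ true
  adj-suppress⁺ {p} {q} p≢w q≢w h rewrite eqb-≢ p≢w | eqb-≢ q≢w
    with (eqb p a ∧ eqb q b) ∨ (eqb p b ∧ eqb q a) | samePair-reflects a b p q | h
  ... | true  | _       | _        = refl
  ... | false | ofⁿ ¬pq | inj₁ pq  = contradiction pq ¬pq
  ... | false | _       | inj₂ pqG = pqG

  adj-suppress⁻ : ∀ {p q} → adj N p q ≡ true →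
                  p ≢ w × q ≢ w × (SamePair a b p q ⊎ adj G p q ≡ true)
  adj-suppress⁻ {p} {q} h with p ≟ w | q ≟ w
  ... | yes _   | _       = contradiction h λ ()
  ... | no _    | yes _   = contradiction h λ ()
  ... | no p≢w | no q≢w with (eqb p a ∧ eqb q b) ∨ (eqb p b ∧ eqb q a) | samePair-reflects a b p q
  ...   | true  | ofʸ pq = p≢w , q≢w , inj₁ pq
  ...   | false | _      = p≢w , q≢w , inj₂ h

  suppress-symmetric : SymmetricAdj (adj G) → SymmetricAdj (adj N)
  suppress-symmetric G-sym x y
    rewrite ∨-comm (eqb x w) (eqb y w)
          | ∧-comm (eqb x a) (eqb y b) | ∧-comm (eqb x b) (eqb y a)
          | ∨-comm (eqb y b ∧ eqb x a) (eqb y a ∧ eqb x b)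
          | G-sym x y = refl

  suppress-irreflexive : a ≢ b → IrreflexiveAdj (adj G) → IrreflexiveAdj (adj N)
  suppress-irreflexive a≢b G-irr x with x ≟ w
  ... | yes _ = refl
  ... | no _ with (eqb x a ∧ eqb x b) ∨ (eqb x b ∧ eqb x a) | samePair-reflects a b x x
  ...   | true  | ofʸ (inj₁ (x≡a , x≡b)) = contradiction (trans (sym x≡a) x≡b) a≢b
  ...   | true  | ofʸ (inj₂ (x≡b , x≡a)) = contradiction (trans (sym x≡a) x≡b) a≢b
  ...   | false | _                     = G-irr x

adjacent : ∀ {n} → State n → Fin n → Fin n → Bool
adjacent G u v = alive G v ∧ adj G u v

record Invariant {n} (F : Adj n) (G : State n) : Set where
  field
    symmetric   : SymmetricAdj (adj G)
    irreflexive : IrreflexiveAdj (adj G)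
    acyclic     : Acyclic (adj G)
    pure        : Pure G F

module SuppressionStep {n} {F : Adj n} (F-sym : SymmetricAdj F) {G : State n} {w a b : Fin n}
  (alive-w : alive G w ≡ true) (deg-w : deg G w ≡ 2)
  (alive-a : alive G a ≡ true) (wa : adj G w a ≡ true)
  (alive-b : alive G b ≡ true) (wb : adj G w b ≡ true) (a≢b : a ≢ b)
  (inv : Invariant F G) where

  open Invariant inv
  open Suppression G w a b

  w≢a : w ≢ a
  w≢a = adjacent⇒≢ irreflexive wa

  w≢b : w ≢ b
  w≢b = adjacent⇒≢ irreflexive wb

  neighbours-of-w : ∀ {u} → alive G u ≡ true → adj G w u ≡ true → ∃ λ d → SamePair a b u d
  neighbours-of-w {u} alive-u wu with u ≟ a | u ≟ b
  ... | yes u≡a | _       = b , inj₁ (u≡a , refl)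
  ... | _       | yes u≡b = a , inj₂ (u≡b , refl)
  ... | no u≢a  | no u≢b  =
    contradiction (subst (3 ≤_) deg-w three-neighbours) λ { (s≤s (s≤s ())) }
    where
    three-neighbours : 3 ≤ deg G w
    three-neighbours = count≥3 (∧≡true⁺ alive-a wa) (∧≡true⁺ alive-b wb) (∧≡true⁺ alive-u wu)
                               a≢b (≢-sym u≢a) (≢-sym u≢b)

  pair-alive : ∀ {x y} → SamePair a b x y → alive G y ≡ true
  pair-alive (inj₁ (_ , refl)) = alive-b
  pair-alive (inj₂ (_ , refl)) = alive-a

  pair-adj-w : ∀ {x y} → SamePair a b x y → adj G x w ≡ true
  pair-adj-w (inj₁ (refl , _)) = trans (symmetric a w) wa
  pair-adj-w (inj₂ (refl , _)) = trans (symmetric b w) wb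

  pair≢w : ∀ {x y} → SamePair a b x y → x ≢ w
  pair≢w = adjacent⇒≢ irreflexive ∘ pair-adj-w

  a-b-nonadjacent : adj G a b ≡ false
  a-b-nonadjacent with adj G a b in ab
  ... | false = refl
  ... | true  = contradiction ((trans (symmetric a w) wa , a-w-avoids) ◅ (wb , w-b-avoids) ◅ ε)
                              (acyclic ab)
    where
    a-w-avoids : ¬ SamePair a b a w
    a-w-avoids (inj₁ (_ , w≡b)) = w≢b w≡b
    a-w-avoids (inj₂ (a≡b , _)) = a≢b a≡b
    w-b-avoids : ¬ SamePair a b w b
    w-b-avoids (inj₁ (w≡a , _)) = w≢a w≡a
    w-b-avoids (inj₂ (w≡b , _)) = w≢b w≡b

  pair-nonadjacent : ∀ {x y} → SamePair a b x y → adj G x y ≡ false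
  pair-nonadjacent (inj₁ (refl , refl)) = a-b-nonadjacent
  pair-nonadjacent (inj₂ (refl , refl)) = trans (symmetric b a) a-b-nonadjacent

  F-deg-w≡0 : degF F w ≡ 0
  F-deg-w≡0 = n<1⇒n≡0 (*-cancelˡ-< 2 _ 1 (subst (2 * degF F w <_) deg-w (proj₂ pure w alive-w)))

  F-edge≢w : ∀ {u v} → F u v ≡ true → u ≢ w × v ≢ w
  F-edge≢w {u} {v} uv =
    (λ { refl → contradiction (trans (sym uv) (count≡0⇒false v F-deg-w≡0)) λ () }) ,
    (λ { refl → contradiction (trans (sym uv) (trans (F-sym u w) (count≡0⇒false u F-deg-w≡0))) λ () })

  deg-mono-away : ∀ {u} → u ≢ w → adj G u w ≡ false → deg G u ≤ deg N u
  deg-mono-away {u} u≢w uw = count-mono kept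
    where
    kept : ∀ v → adjacent G u v ≡ true → adjacent N u v ≡ true
    kept v h with ∧≡true⁻ h
    ... | alive-v , uv = ∧≡true⁺ (alive-suppress⁺ alive-v v≢w) (adj-suppress⁺ u≢w v≢w (inj₂ uv))
      where
      v≢w : v ≢ w
      v≢w refl = contradiction (trans (sym uv) uw) λ ()

  deg-mono-pair : ∀ {u d} → SamePair a b u d → deg G u ≤ deg N u
  deg-mono-pair {u} {d} ud =
    count-exchange-≤ (∧≡true⁺ alive-w (pair-adj-w ud)) (∧≡true⁺ alive-d ud-N) kept
    where
    u≢w = pair≢w ud
    d≢w = pair≢w (samePair-swap ud)
    alive-d : alive N d ≡ true
    alive-d = alive-suppress⁺ (pair-alive ud) d≢w
    ud-N : adj N u d ≡ true
    ud-N = adj-suppress⁺ u≢w d≢w (inj₁ ud)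
    kept : ∀ v → (adjacent G u without w) v ≡ true → (adjacent N u without d) v ≡ true
    kept v h with without⁻ {p = adjacent G u} h
    ... | h′ , v≢w with ∧≡true⁻ h′
    ...   | alive-v , uv =
      without⁺ {p = adjacent N u} (∧≡true⁺ (alive-suppress⁺ alive-v v≢w) (adj-suppress⁺ u≢w v≢w (inj₂ uv))) v≢d
      where
      v≢d : v ≢ d
      v≢d refl = contradiction (trans (sym uv) (pair-nonadjacent ud)) λ ()

  deg-mono : ∀ {u} → alive G u ≡ true → u ≢ w → deg G u ≤ deg N u
  deg-mono {u} alive-u u≢w with adj G u w in uw
  ... | false = deg-mono-away u≢w uw
  ... | true  = deg-mono-pair (proj₂ (neighbours-of-w alive-u (trans (symmetric w u) uw)))

  pure-suppress : Pure N F
  pure-suppress = F⊆N , degree-bound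
    where
    F⊆N : SubsetE N F
    F⊆N u v uv with F-edge≢w uv | proj₁ pure u v uv
    ... | u≢w , v≢w | alive-u , alive-v , uvG =
      alive-suppress⁺ alive-u u≢w , alive-suppress⁺ alive-v v≢w , adj-suppress⁺ u≢w v≢w (inj₂ uvG)
    degree-bound : ∀ u → alive N u ≡ true → 2 * degF F u < deg N u
    degree-bound u alive-N-u with alive-suppress⁻ alive-N-u
    ... | alive-u , u≢w = <-≤-trans (proj₂ pure u alive-u) (deg-mono alive-u u≢w)

  avoids-w : ∀ {x y q} → x ≢ w → y ≢ w → ¬ SamePair x y w q
  avoids-w x≢w _   (inj₁ (w≡x , _)) = x≢w (sym w≡x)
  avoids-w _   y≢w (inj₂ (w≡y , _)) = y≢w (sym w≡y)

  -- the new edge is replaced by the path through w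
  lift-avoiding : ∀ {x y} → x ≢ w → y ≢ w → EdgeAvoiding (adj N) x y ⇒ Star (EdgeAvoiding (adj G) x y)
  lift-avoiding x≢w y≢w (pq , avoids) with adj-suppress⁻ pq
  ... | _ , _ , inj₂ pqG = (pqG , avoids) ◅ ε
  ... | _ , _ , inj₁ pr  =
    (pair-adj-w pr , avoids-w x≢w y≢w ∘ samePair-swap) ◅
    (trans (symmetric w _) (pair-adj-w (samePair-swap pr)) , avoids-w x≢w y≢w) ◅ ε

  lift-detour : ∀ {x y} → SamePair a b x y → EdgeAvoiding (adj N) x y ⇒ Star (EdgeAvoiding (adj G) x w)
  lift-detour xy (pq , avoids) with adj-suppress⁻ pq
  ... | _ , _ , inj₁ pr = contradiction (samePair-euclidean xy pr) avoids
  ... | p≢w , q≢w , inj₂ pqG = (pqG , λ { (inj₁ (_ , q≡w)) → q≢w q≡w ; (inj₂ (p≡w , _)) → p≢w p≡w }) ◅ ε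

  -- a detour between the ends of the new edge closes a cycle through w in G
  acyclic-suppress : Acyclic (adj N)
  acyclic-suppress {x} {y} xy detour with adj-suppress⁻ xy
  ... | x≢w , y≢w , inj₂ xyG = acyclic xyG (concat (map (lift-avoiding x≢w y≢w) detour))
  ... | _   , y≢w , inj₁ pr  = acyclic (pair-adj-w pr)
    (concat (map (lift-detour pr) detour) ◅◅ (pair-adj-w (samePair-swap pr) , y-w-avoids) ◅ ε)
    where
    y-w-avoids : ¬ SamePair x w y w
    y-w-avoids (inj₁ (y≡x , _)) = adjacent⇒≢ (suppress-irreflexive a≢b irreflexive) xy (sym y≡x)
    y-w-avoids (inj₂ (y≡w , _)) = y≢w y≡w

  invariant-suppress : Invariant F N
  invariant-suppress = record
    { symmetric   = suppress-symmetric symmetric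
    ; irreflexive = suppress-irreflexive a≢b irreflexive
    ; acyclic     = acyclic-suppress
    ; pure        = pure-suppress
    }

invariant-steps : ∀ {n} {F : Adj n} → SymmetricAdj F →
                  ∀ {G H} → Star Step G H → Invariant F G → Invariant F H
invariant-steps F-sym ε inv = inv
invariant-steps F-sym (suppr G w a b alive-w deg-w alive-a wa alive-b wb a≢b ◅ steps) inv =
  invariant-steps F-sym steps
    (SuppressionStep.invariant-suppress F-sym alive-w deg-w alive-a wa alive-b wb a≢b inv)

tree-invariant : ∀ {n} {T F : Adj n} → IsTree T → Pure (full T) F → Invariant F (full T)
tree-invariant tree pure = record
  { symmetric   = proj₁ tree
  ; irreflexive = proj₁ (proj₂ tree)
  ; acyclic     = tree⇒acyclic tree
  ; pure        = pure
  }

lemma17 : ∀ {n} (T : Adj n) → IsTree T →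
          (T² : State n) → IsT² T T² →
          (F : Adj n) → SymmetricAdj F →
          Pure (full T) F → Pure T² F
lemma17 T tree T² (steps , _) F F-sym pure =
  Invariant.pure (invariant-steps F-sym steps (tree-invariant tree pure))
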